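{- Let $r \geq 3$ and let $(G,f)$ be an edge-colored graph with $\delta(G) \geq \frac{r-1}{r}|V(G)|$ containing no $K_r$-template. Suppose $G$ has an $(r+1)$-clique $K$ with no monochromatic vertex whose edges use at most $\binom{r}{2}$ different colors, and suppose no $(r+2)$-clique of $G$ contains $K$. Then there is $U \subseteq V(G)$ with $|U| \geq \delta(G)$ such that the edges of $G[U]$ use at most $\binom{r}{2}$ different colors.
   Context: A vertex $u$ of a clique $M$ is monochromatic in $M$ if all edges of $M$ incident to $u$ have the same color. For $K' \subseteq V(G)$, $N(K')$ is the common neighborhood of $K'$. An even cycle $w_1 \dots w_{2k} w_1$ is balanced if the multisets $\{f(w_1w_2), f(w_3w_4), \dots, f(w_{2k-1}w_{2k})\}$ and $\{f(w_2w_3), \dots, f(w_{2k}w_1)\}$ coincide, and unbalanced otherwise. A $K_r$-template is a subgraph consisting of a copy $K'$ of $K_{r-2}$ together with an unbalanced cycle of length $4$ or $6$ contained in $N(K')$. -}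

module Defs where

open import Data.Nat using (ℕ; zero; suc; _+_; _*_; _∸_; _≤_)
open import Data.Bool using (Bool; true; false)
open import Data.Fin using (Fin)
open import Data.Fin.Subset using (Subset; _∈_; _⊆_; ∣_∣)
open import Data.Vec using (tabulate)
open import Data.List using (List; []; _∷_; _++_; [_]; map; zip; length)
open import Data.List.Relation.Unary.All using (All)
open import Data.List.Relation.Unary.Unique.Propositional using (Unique)
open import Data.List.Relation.Binary.Permutation.Propositional using (_↭_)
open import Data.List.Membership.Propositional using () renaming (_∈_ to _∈ₗ_)
open import Data.Product using (Σ; ∃; _×_; _,_; proj₁; proj₂)
open import Data.Sum using (_⊎_)
open import Relation.Binary.PropositionalEquality using (_≡_; _≢_)
open import Relation.Nullary using (¬_)

record Graph (n : ℕ) : Set where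
  field
    Adj   : Fin n → Fin n → Bool
    sym   : ∀ u v → Adj u v ≡ Adj v u
    irrfl : ∀ u → Adj u u ≡ false
open Graph public

-- An edge-coloring: a symmetric color assignment (only its values on edges matter).
-- Colors are natural numbers.
record Coloring {n : ℕ} (G : Graph n) : Set where
  field
    col    : Fin n → Fin n → ℕ
    colSym : ∀ u v → col u v ≡ col v u
open Coloring public

module _ {n : ℕ} (G : Graph n) where

  Edge : Fin n → Fin n → Set
  Edge u v = Adj G u v ≡ true

  deg : Fin n → ℕ
  deg u = ∣ tabulate (Adj G u) ∣

  IsMinDegree : ℕ → Set
  IsMinDegree d = (∀ v → d ≤ deg v) × (∃ λ v → deg v ≡ d)

  IsClique : Subset n → Set
  IsClique S = ∀ u v → u ∈ S → v ∈ S → u ≢ v → Edge u v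

  IsKClique : ℕ → Subset n → Set
  IsKClique k S = IsClique S × ∣ S ∣ ≡ k

  InCommonNbhd : Subset n → Fin n → Set
  InCommonNbhd K' v = ∀ u → u ∈ K' → Edge u v

rot : {A : Set} → List A → List A
rot []       = []
rot (x ∷ xs) = xs ++ [ x ]

cycEdges : {A : Set} → List A → List (A × A)
cycEdges ws = zip ws (rot ws)

odds evens : {A : Set} → List A → List A
odds []           = []
odds (x ∷ [])     = x ∷ []
odds (x ∷ y ∷ xs) = x ∷ odds xs
evens []           = []
evens (x ∷ [])     = []
evens (x ∷ y ∷ xs) = y ∷ evens xs

module _ {n : ℕ} {G : Graph n} (f : Coloring G) where

  edgeColor : Fin n × Fin n → ℕ
  edgeColor (u , v) = col f u v

  -- cycle w₁…w_{2k}w₁ given as the list [w₁,…,w_{2k}]: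
  -- balanced iff {f(w₁w₂), f(w₃w₄), …} = {f(w₂w₃), …, f(w_{2k}w₁)} as multisets
  Balanced : List (Fin n) → Set
  Balanced ws = map edgeColor (odds (cycEdges ws)) ↭ map edgeColor (evens (cycEdges ws))

  IsCycle : List (Fin n) → Set
  IsCycle ws = Unique ws × All (λ e → Edge G (proj₁ e) (proj₂ e)) (cycEdges ws)

  HasTemplate : ℕ → Set
  HasTemplate r = Σ (Subset n) λ K' → IsKClique G (r ∸ 2) K' ×
    Σ (List (Fin n)) λ ws → (length ws ≡ 4 ⊎ length ws ≡ 6) × IsCycle ws
      × All (InCommonNbhd G K') ws × ¬ Balanced ws

  Monochromatic : Subset n → Fin n → Set
  Monochromatic M u = ∀ v w → v ∈ M → w ∈ M → v ≢ u → w ≢ u → col f u v ≡ col f u w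

  AtMostColors : ℕ → Subset n → Set
  AtMostColors k S = Σ (List ℕ) λ cs → length cs ≤ k ×
    (∀ u v → u ∈ S → v ∈ S → Edge G u v → col f u v ∈ₗ cs)

-- A vertex v has at most r neighbours in K, as otherwise K ∪ {v} would be an
-- (r+2)-clique; let U be the set of vertices with exactly r neighbours in K. Double counting
-- the edges between K and V(G) gives (r+1)δ ≤ Σ_v |K ∩ N(v)| ≤ (r-1)n + |U|, so |U| ≥ δ
-- because rδ ≥ (r-1)n. Every v ∈ U misses exactly one vertex i of K. Any 4-cycle through
-- v and vertices of K lies in the common neighbourhood of the remaining r-2 vertices of K,
-- hence is balanced; as i is not monochromatic in K this forces f(va) = f(ia) for all
-- a ∈ K - i. One more such balanced 4-cycle then shows that every edge of G[U] has the
-- colour of an edge of K.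
module Submission where

open import Defs
open import Data.Nat using (ℕ; zero; suc; _+_; _*_; _∸_; _≤_; _≥_; _<_; z≤n; s≤s; _≤ᵇ_; _≟_)
open import Data.Nat.Combinatorics using (_C_)
open import Data.Nat.Properties
  using (≤ᵇ-reflects-≤; ≤-trans; ≤-pred; ≤⇒≯; ≤-antisym; ≤-reflexive; <⇒≢; n≤1+n; +-cancelʳ-≤; +-monoʳ-≤;
         +-comm; +-suc; *-comm; *-identityˡ; +-mono-≤; m≤n+m∸n; ∸-monoˡ-≤; ≰⇒>; suc-injective;
         +-*-semiring; module ≤-Reasoning)
open import Data.Bool using (Bool; true; false; _∧_)
open import Data.Bool.Properties using () renaming (_≟_ to _≟ᵇ_)
open import Data.Fin using (Fin) renaming (_≟_ to _≟ᶠ_)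
open import Data.Fin.Properties using (any?)
open import Data.Fin.Subset
  using (Subset; inside; outside; _∈_; _∉_; _⊆_; ∣_∣; _∩_; _∪_; _─_; _-_; ⁅_⁆; Nonempty)
open import Data.Fin.Subset.Properties
  using (_∈?_; nonempty?; Empty-unique; ∣⊥∣≡0; p─q⊆p; x∈p∧x≢y⇒x∈p-y; x∈p⇒∣p-x∣<∣p∣; p⊆q⇒∣p∣≤∣q∣;
         x∈⁅x⁆; x∈⁅y⁆⇒x≡y; x∈p∩q⁻; x∈p∪q⁻; x∈p∪q⁺; p⊆p∪q; drop-not-there; ∪-identityʳ)
open import Data.Vec using ([]; _∷_; here; there; lookup; tabulate)
open import Data.Vec.Properties using (lookup∘tabulate; lookup-zipWith; []=⇒lookup)
open import Data.List using ([]; _∷_)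
open import Data.List.Relation.Unary.All using (All; []; _∷_)
open import Data.List.Relation.Unary.AllPairs using ([]; _∷_)
open import Data.List.Relation.Unary.Any using (here; there)
open import Data.List.Relation.Binary.Permutation.Propositional using (_↭_; ↭-refl; ↭-swap; ↭-trans)
open import Data.List.Relation.Binary.Permutation.Propositional.Properties
  using (∈-resp-↭; drop-∷; ↭-singleton-inv)
open import Data.List.Membership.Propositional using () renaming (_∈_ to _∈ₗ_)
open import Data.Product using (Σ; ∃; ∃₂; _×_; _,_; proj₁; proj₂)
open import Data.Sum using (_⊎_; inj₁; inj₂)
open import Data.Empty using (⊥-elim)
open import Function using (_∘_)
open import Relation.Nullary using (¬_; yes; no; contradiction)
open import Relation.Nullary.Reflects using (ofʸ; ofⁿ)
open import Relation.Nullary.Decidable using (_×-dec_; _⊎-dec_; ¬?; decidable-stable)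
open import Relation.Binary.PropositionalEquality as ≡ using (_≡_; _≢_; refl; cong; cong₂; subst; ≢-sym)
open import Algebra.Properties.Semiring.Sum +-*-semiring
  using (sum; sum-syntax; sum-cong-≗; ∑-comm; ∑-distrib-+; *-distribʳ-sum)

private
  variable
    n : ℕ
    p : Subset n
    x y z : Fin n
    w₁ w₂ w₃ w₄ : Fin n

x∈p─q⇒x∉q : ∀ {q : Subset n} → x ∈ p ─ q → x ∉ q
x∈p─q⇒x∉q {x = x} {p = p} {q = q} x∈p─q x∈q
  with ≡.trans (≡.sym (lookup-zipWith _ x p q)) ([]=⇒lookup x∈p─q)
... | diff≡inside rewrite []=⇒lookup x∈q = outside≢inside diff≡inside
  where
  outside≢inside : outside ≢ inside
  outside≢inside ()

x∈p-y⇒x∈p∧x≢y : x ∈ p - y → x ∈ p × x ≢ y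
x∈p-y⇒x∈p∧x≢y {p = p} {y = y} x∈p-y = p─q⊆p p ⁅ y ⁆ x∈p-y , λ { refl → x∈p─q⇒x∉q x∈p-y (x∈⁅x⁆ y) }

p⊆[p-x]∪⁅x⁆ : ∀ (p : Subset n) x → p ⊆ (p - x) ∪ ⁅ x ⁆
p⊆[p-x]∪⁅x⁆ p x {u} u∈p with u ≟ᶠ x
... | yes refl = x∈p∪q⁺ (inj₂ (x∈⁅x⁆ x))
... | no u≢x   = x∈p∪q⁺ (inj₁ (x∈p∧x≢y⇒x∈p-y u∈p u≢x))

x∉p⇒∣p∪⁅x⁆∣≡1+∣p∣ : x ∉ p → ∣ p ∪ ⁅ x ⁆ ∣ ≡ suc ∣ p ∣
x∉p⇒∣p∪⁅x⁆∣≡1+∣p∣ {x = Fin.zero}  {p = inside  ∷ p} x∉p = contradiction here x∉p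
x∉p⇒∣p∪⁅x⁆∣≡1+∣p∣ {x = Fin.zero}  {p = outside ∷ p} x∉p = cong (suc ∘ ∣_∣) (∪-identityʳ p)
x∉p⇒∣p∪⁅x⁆∣≡1+∣p∣ {x = Fin.suc x} {p = inside  ∷ p} x∉p = cong suc (x∉p⇒∣p∪⁅x⁆∣≡1+∣p∣ (drop-not-there x∉p))
x∉p⇒∣p∪⁅x⁆∣≡1+∣p∣ {x = Fin.suc x} {p = outside ∷ p} x∉p = x∉p⇒∣p∪⁅x⁆∣≡1+∣p∣ (drop-not-there x∉p)

∣p∣≤1+∣p-x∣ : ∀ (p : Subset n) x → ∣ p ∣ ≤ suc ∣ p - x ∣
∣p∣≤1+∣p-x∣ p x = ≤-trans (p⊆q⇒∣p∣≤∣q∣ (p⊆[p-x]∪⁅x⁆ p x))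
  (≤-reflexive (x∉p⇒∣p∪⁅x⁆∣≡1+∣p∣ {p = p - x} (λ x∈p-x → proj₂ (x∈p-y⇒x∈p∧x≢y x∈p-x) refl)))

x∈p⇒1+∣p-x∣≡∣p∣ : x ∈ p → suc ∣ p - x ∣ ≡ ∣ p ∣
x∈p⇒1+∣p-x∣≡∣p∣ {x = x} {p = p} x∈p = ≤-antisym (x∈p⇒∣p-x∣<∣p∣ x∈p) (∣p∣≤1+∣p-x∣ p x)

p-x-y-z⊆p-x : p - x - y - z ⊆ p - x
p-x-y-z⊆p-x {p = p} {x = x} {y = y} {z = z} = p─q⊆p (p - x) ⁅ y ⁆ ∘ p─q⊆p (p - x - y) ⁅ z ⁆

p-x-y-z⊆p-y : p - x - y - z ⊆ p - y
p-x-y-z⊆p-y {p = p} {x = x} {y = y} {z = z} u∈ with x∈p-y⇒x∈p∧x≢y (p─q⊆p (p - x - y) ⁅ z ⁆ u∈)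
... | u∈p-x , u≢y = x∈p∧x≢y⇒x∈p-y (p─q⊆p p ⁅ x ⁆ u∈p-x) u≢y

p-x-y-z⊆p-z : p - x - y - z ⊆ p - z
p-x-y-z⊆p-z {p = p} {x = x} {y = y} u∈ with x∈p-y⇒x∈p∧x≢y u∈
... | u∈p-x-y , u≢z = x∈p∧x≢y⇒x∈p-y (p─q⊆p p ⁅ x ⁆ (p─q⊆p (p - x) ⁅ y ⁆ u∈p-x-y)) u≢z

0<∣p∣⇒Nonempty : ∀ {n} {p : Subset n} → 0 < ∣ p ∣ → Nonempty p
0<∣p∣⇒Nonempty {n = n} {p = p} 0<∣p∣ with nonempty? p
... | yes ne = ne
... | no ¬ne = contradiction (≡.trans (cong ∣_∣ (Empty-unique ¬ne)) (∣⊥∣≡0 n)) (≢-sym (<⇒≢ 0<∣p∣))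

𝟙 : Bool → ℕ
𝟙 true  = 1
𝟙 false = 0

∑-mono-≤ : ∀ {f g : Fin n → ℕ} → (∀ i → f i ≤ g i) → sum f ≤ sum g
∑-mono-≤ {zero}  _   = z≤n
∑-mono-≤ {suc n} f≤g = +-mono-≤ (f≤g Fin.zero) (∑-mono-≤ (f≤g ∘ Fin.suc))

∑-const : ∀ n m → ∑[ i < n ] m ≡ n * m
∑-const zero    m = refl
∑-const (suc n) m = cong (m +_) (∑-const n m)

∣p∣≡∑𝟙 : ∀ (p : Subset n) → ∣ p ∣ ≡ ∑[ i < n ] 𝟙 (lookup p i)
∣p∣≡∑𝟙 []            = refl
∣p∣≡∑𝟙 (inside  ∷ p) = cong suc (∣p∣≡∑𝟙 p)
∣p∣≡∑𝟙 (outside ∷ p) = ∣p∣≡∑𝟙 p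

∣tabulate∣≡∑𝟙 : ∀ (g : Fin n → Bool) → ∣ tabulate g ∣ ≡ ∑[ i < n ] 𝟙 (g i)
∣tabulate∣≡∑𝟙 g = ≡.trans (∣p∣≡∑𝟙 (tabulate g)) (sum-cong-≗ (cong 𝟙 ∘ lookup∘tabulate g))

atLeast : ℕ → (Fin n → ℕ) → Subset n
atLeast t c = tabulate (λ v → t ≤ᵇ c v)

∈atLeast⇒≤ : ∀ {t} {c : Fin n → ℕ} {v} → v ∈ atLeast t c → t ≤ c v
∈atLeast⇒≤ {t = t} {c} {v} v∈
  with t ≤ᵇ c v | ≤ᵇ-reflects-≤ t (c v)
     | ≡.trans (≡.sym (lookup∘tabulate (λ v → t ≤ᵇ c v) v)) ([]=⇒lookup v∈)
... | true  | ofʸ t≤cv | _  = t≤cv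
... | false | _        | ()

∑≤∣atLeast∣+n*[t∸1] : ∀ t (c : Fin n → ℕ) → (∀ v → c v ≤ t) → sum c ≤ ∣ atLeast t c ∣ + n * (t ∸ 1)
∑≤∣atLeast∣+n*[t∸1] {n} t c c≤t = begin
  ∑[ v < n ] c v                                 ≤⟨ ∑-mono-≤ split ⟩
  ∑[ v < n ] (𝟙 (t ≤ᵇ c v) + (t ∸ 1))           ≡⟨ ∑-distrib-+ (𝟙 ∘ (t ≤ᵇ_) ∘ c) (λ _ → t ∸ 1) ⟩
  ∑[ v < n ] 𝟙 (t ≤ᵇ c v) + ∑[ v < n ] (t ∸ 1)
    ≡⟨ cong₂ _+_ (≡.sym (∣tabulate∣≡∑𝟙 (λ v → t ≤ᵇ c v))) (∑-const n (t ∸ 1)) ⟩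
  ∣ atLeast t c ∣ + n * (t ∸ 1)                  ∎
  where
  open ≤-Reasoning
  split : ∀ v → c v ≤ 𝟙 (t ≤ᵇ c v) + (t ∸ 1)
  split v with t ≤ᵇ c v | ≤ᵇ-reflects-≤ t (c v)
  ... | true  | _          = ≤-trans (c≤t v) (m≤n+m∸n t 1)
  ... | false | ofⁿ t≰cv = ∸-monoˡ-≤ 1 (≰⇒> t≰cv)

Edge-sym : ∀ (G : Graph n) {u v} → Edge G u v → Edge G v u
Edge-sym G {u} {v} e = ≡.trans (sym G v u) e

Edge⇒≢ : ∀ (G : Graph n) {u v} → Edge G u v → u ≢ v
Edge⇒≢ G {u} e refl with ≡.trans (≡.sym e) (irrfl G u)
... | ()

nbrs : Graph n → Fin n → Subset n
nbrs G v = tabulate (Adj G v)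

∈nbrs⇒Edge : ∀ (G : Graph n) {u v} → u ∈ nbrs G v → Edge G v u
∈nbrs⇒Edge G {u} {v} u∈ = ≡.trans (≡.sym (lookup∘tabulate (Adj G v) u)) ([]=⇒lookup u∈)

∩nbrs⊆- : ∀ (G : Graph n) S {x v} → ¬ Edge G x v → S ∩ nbrs G v ⊆ S - x
∩nbrs⊆- G S {v = v} ¬xv u∈ with x∈p∩q⁻ S (nbrs G v) u∈
... | u∈S , u∈N = x∈p∧x≢y⇒x∈p-y u∈S λ { refl → ¬xv (Edge-sym G (∈nbrs⇒Edge G u∈N)) }

InCommonNbhd-anti : ∀ (G : Graph n) {K₁ K₂ v} → K₁ ⊆ K₂ → InCommonNbhd G K₂ v → InCommonNbhd G K₁ v
InCommonNbhd-anti G K₁⊆K₂ v-nbhd u u∈K₁ = v-nbhd u (K₁⊆K₂ u∈K₁)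

∣S∣*d≤∑∣S∩nbrs∣ : ∀ (G : Graph n) {d} → (∀ v → d ≤ deg G v) → (S : Subset n) →
                  ∣ S ∣ * d ≤ ∑[ v < n ] ∣ S ∩ nbrs G v ∣
∣S∣*d≤∑∣S∩nbrs∣ {n} G {d} d≤deg S = begin
  ∣ S ∣ * d                                          ≡⟨ cong (_* d) (∣p∣≡∑𝟙 S) ⟩
  (∑[ u < n ] 𝟙 (lookup S u)) * d                    ≡⟨ *-distribʳ-sum d (𝟙 ∘ lookup S) ⟩
  ∑[ u < n ] (𝟙 (lookup S u) * d)                    ≤⟨ ∑-mono-≤ row ⟩
  ∑[ u < n ] ∑[ v < n ] 𝟙 (lookup S u ∧ Adj G v u)   ≡⟨ ∑-comm (λ u v → 𝟙 (lookup S u ∧ Adj G v u)) ⟩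
  ∑[ v < n ] ∑[ u < n ] 𝟙 (lookup S u ∧ Adj G v u)   ≡⟨ sum-cong-≗ column ⟨
  ∑[ v < n ] ∣ S ∩ nbrs G v ∣                        ∎
  where
  open ≤-Reasoning
  row : ∀ u → 𝟙 (lookup S u) * d ≤ ∑[ v < n ] 𝟙 (lookup S u ∧ Adj G v u)
  row u with lookup S u
  ... | false = z≤n
  ... | true  = begin
    1 * d                         ≡⟨ *-identityˡ d ⟩
    d                             ≤⟨ d≤deg u ⟩
    deg G u                       ≡⟨ ∣tabulate∣≡∑𝟙 (Adj G u) ⟩
    ∑[ v < n ] 𝟙 (Adj G u v)      ≡⟨ sum-cong-≗ (cong 𝟙 ∘ sym G u) ⟩
    ∑[ v < n ] 𝟙 (Adj G v u)      ∎
  column : ∀ v → ∣ S ∩ nbrs G v ∣ ≡ ∑[ u < n ] 𝟙 (lookup S u ∧ Adj G v u)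
  column v = ≡.trans (∣p∣≡∑𝟙 (S ∩ nbrs G v)) (sum-cong-≗ λ u → cong 𝟙
    (≡.trans (lookup-zipWith _∧_ u S (nbrs G v)) (cong (lookup S u ∧_) (lookup∘tabulate (Adj G v) u))))

[x]↭[y]⇒x≡y : ∀ {A : Set} {x y : A} → x ∷ [] ↭ y ∷ [] → x ≡ y
[x]↭[y]⇒x≡y x↭y with ↭-singleton-inv x↭y
... | refl = refl

↭-pair⁻ : ∀ {A : Set} {a b c d : A} → a ∷ b ∷ [] ↭ c ∷ d ∷ [] → (a ≡ c × b ≡ d) ⊎ (a ≡ d × b ≡ c)
↭-pair⁻ {c = c} ab↭cd with ∈-resp-↭ ab↭cd (here refl)
... | here refl         = inj₁ (refl , [x]↭[y]⇒x≡y (drop-∷ ab↭cd))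
... | there (here refl) = inj₂ (refl , [x]↭[y]⇒x≡y (drop-∷ (↭-trans ab↭cd (↭-swap c _ ↭-refl))))

module _ {G : Graph n} (f : Coloring G) where

  square-isCycle : Edge G w₁ w₂ → Edge G w₂ w₃ → Edge G w₃ w₄ → Edge G w₄ w₁ → w₁ ≢ w₃ → w₂ ≢ w₄ →
                   IsCycle f (w₁ ∷ w₂ ∷ w₃ ∷ w₄ ∷ [])
  square-isCycle e₁₂ e₂₃ e₃₄ e₄₁ w₁≢w₃ w₂≢w₄ =
    ( (Edge⇒≢ G e₁₂ ∷ w₁≢w₃ ∷ ≢-sym (Edge⇒≢ G e₄₁) ∷ [])
    ∷ (Edge⇒≢ G e₂₃ ∷ w₂≢w₄ ∷ [])
    ∷ (Edge⇒≢ G e₃₄ ∷ [])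
    ∷ [] ∷ [])
    , (e₁₂ ∷ e₂₃ ∷ e₃₄ ∷ e₄₁ ∷ [])

  -- Balanced f (w₁ ∷ w₂ ∷ w₃ ∷ w₄ ∷ []), unfolded into its two possible matchings (see ↭-pair⁻)
  SquareBalanced : Fin n → Fin n → Fin n → Fin n → Set
  SquareBalanced w₁ w₂ w₃ w₄ =
    (col f w₁ w₂ ≡ col f w₂ w₃ × col f w₃ w₄ ≡ col f w₄ w₁) ⊎
    (col f w₁ w₂ ≡ col f w₄ w₁ × col f w₃ w₄ ≡ col f w₂ w₃)

  square-balanced : ∀ r {K′} → ¬ HasTemplate f r → IsKClique G (r ∸ 2) K′ →
                    IsCycle f (w₁ ∷ w₂ ∷ w₃ ∷ w₄ ∷ []) → All (InCommonNbhd G K′) (w₁ ∷ w₂ ∷ w₃ ∷ w₄ ∷ []) →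
                    SquareBalanced w₁ w₂ w₃ w₄
  square-balanced {w₁} {w₂} {w₃} {w₄} r {K′} no-template K′-clique cycle in-N[K′]
    with (col f w₁ w₂ ≟ col f w₂ w₃ ×-dec col f w₃ w₄ ≟ col f w₄ w₁)
         ⊎-dec (col f w₁ w₂ ≟ col f w₄ w₁ ×-dec col f w₃ w₄ ≟ col f w₂ w₃)
  ... | yes balanced  = balanced
  ... | no unbalanced =
    ⊥-elim (no-template (K′ , K′-clique , _ , inj₁ refl , cycle , in-N[K′] , unbalanced ∘ ↭-pair⁻))

module OnClique {G : Graph n} {r} {K : Subset n} (K-clique : IsKClique G (r + 1) K) where

  K-edge : ∀ {u v} → u ∈ K → v ∈ K → u ≢ v → Edge G u v
  K-edge = proj₁ K-clique _ _

  K-member-nbhd : ∀ {x} → x ∈ K → InCommonNbhd G (K - x) x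
  K-member-nbhd x∈K u u∈K-x with x∈p-y⇒x∈p∧x≢y u∈K-x
  ... | u∈K , u≢x = K-edge u∈K x∈K u≢x

  ∣K-x∣≡r : ∀ {x} → x ∈ K → ∣ K - x ∣ ≡ r
  ∣K-x∣≡r x∈K = suc-injective (≡.trans (x∈p⇒1+∣p-x∣≡∣p∣ x∈K) (≡.trans (proj₂ K-clique) (+-comm r 1)))

  K-minus-three : ∀ {p q s} → p ∈ K → q ∈ K → s ∈ K → p ≢ q → p ≢ s → q ≢ s →
                  IsKClique G (r ∸ 2) (K - p - q - s)
  K-minus-three {p} {q} {s} p∈K q∈K s∈K p≢q p≢s q≢s =
    (λ u v u∈ v∈ → K-edge (⊆K u∈) (⊆K v∈)) , cong (_∸ 2) size
    where
    ⊆K : K - p - q - s ⊆ K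
    ⊆K = p─q⊆p K ⁅ p ⁆ ∘ p-x-y-z⊆p-x
    q∈K-p : q ∈ K - p
    q∈K-p = x∈p∧x≢y⇒x∈p-y q∈K (≢-sym p≢q)
    s∈K-p-q : s ∈ K - p - q
    s∈K-p-q = x∈p∧x≢y⇒x∈p-y (x∈p∧x≢y⇒x∈p-y s∈K (≢-sym p≢s)) (≢-sym q≢s)
    size : suc (suc ∣ K - p - q - s ∣) ≡ r
    size = ≡.trans (cong suc (x∈p⇒1+∣p-x∣≡∣p∣ s∈K-p-q)) (≡.trans (x∈p⇒1+∣p-x∣≡∣p∣ q∈K-p) (∣K-x∣≡r p∈K))

  0<∣K-x-y∣ : 2 ≤ r → ∀ x y → 0 < ∣ K - x - y ∣
  0<∣K-x-y∣ 2≤r x y = ≤-pred (≤-trans 2≤r (≤-pred (begin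
    suc r                   ≡⟨ +-comm 1 r ⟩
    r + 1                   ≡⟨ proj₂ K-clique ⟨
    ∣ K ∣                   ≤⟨ ∣p∣≤1+∣p-x∣ K x ⟩
    suc ∣ K - x ∣           ≤⟨ s≤s (∣p∣≤1+∣p-x∣ (K - x) y) ⟩
    suc (suc ∣ K - x - y ∣) ∎)))
    where open ≤-Reasoning

  fresh : 2 ≤ r → ∀ i j → ∃ λ t → t ∈ K × t ≢ i × t ≢ j
  fresh 2≤r i j with 0<∣p∣⇒Nonempty (0<∣K-x-y∣ 2≤r i j)
  ... | t , t∈K-i-j with x∈p-y⇒x∈p∧x≢y t∈K-i-j
  ... | t∈K-i , t≢j with x∈p-y⇒x∈p∧x≢y t∈K-i
  ... | t∈K , t≢i = t , t∈K , t≢i , t≢j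

  -- For v ∈ K this forces i = v, so vertices of K need no separate treatment.
  MissesOnly : Fin n → Fin n → Set
  MissesOnly v i = i ∈ K × ¬ Edge G i v × InCommonNbhd G (K - i) v

  MissesOnly⇒Edge : ∀ {v i a} → MissesOnly v i → a ∈ K → a ≢ i → Edge G a v
  MissesOnly⇒Edge (_ , _ , v-nbhd) a∈K a≢i = v-nbhd _ (x∈p∧x≢y⇒x∈p-y a∈K a≢i)

  module Coloured (f : Coloring G) (no-template : ¬ HasTemplate f r)
                  (nonmono : ∀ u → u ∈ K → ¬ Monochromatic f K u) where

    -- If col v a ≢ col i a, every square v a i b forces col i b ≡ col i a, so i would be monochromatic.
    clone : ∀ {v i a} → MissesOnly v i → a ∈ K → a ≢ i → col f v a ≡ col f i a
    clone {v} {i} {a} v-misses@(i∈K , _ , v-nbhd) a∈K a≢i with v ≟ᶠ i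
    ... | yes refl = refl
    ... | no v≢i with col f v a ≟ col f i a
    ...   | yes same  = same
    ...   | no differ = ⊥-elim (nonmono i i∈K λ x y x∈K y∈K x≢i y≢i →
                                  ≡.trans (towards-a x∈K x≢i) (≡.sym (towards-a y∈K y≢i)))
      where
      towards-a : ∀ {b} → b ∈ K → b ≢ i → col f i b ≡ col f i a
      towards-a {b} b∈K b≢i with b ≟ᶠ a
      ... | yes refl = refl
      ... | no b≢a
        with square-balanced f r no-template
               (K-minus-three i∈K a∈K b∈K (≢-sym a≢i) (≢-sym b≢i) (≢-sym b≢a))
               (square-isCycle f (Edge-sym G (MissesOnly⇒Edge v-misses a∈K a≢i)) (K-edge a∈K i∈K a≢i)
                                 (K-edge i∈K b∈K (≢-sym b≢i)) (MissesOnly⇒Edge v-misses b∈K b≢i)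
                                 v≢i (≢-sym b≢a))
               ( InCommonNbhd-anti G p-x-y-z⊆p-x v-nbhd
               ∷ InCommonNbhd-anti G p-x-y-z⊆p-y (K-member-nbhd a∈K)
               ∷ InCommonNbhd-anti G p-x-y-z⊆p-x (K-member-nbhd i∈K)
               ∷ InCommonNbhd-anti G p-x-y-z⊆p-z (K-member-nbhd b∈K) ∷ [])
      ... | inj₁ (va≡ai , _) = ⊥-elim (differ (≡.trans va≡ai (colSym f a i)))
      ... | inj₂ (_ , ib≡ai) = ≡.trans ib≡ai (colSym f a i)

    KColour : ℕ → Set
    KColour c = ∃₂ λ a b → a ∈ K × b ∈ K × a ≢ b × c ≡ col f a b

    edge-colour-same-miss : ∀ {x y i} → 2 ≤ r → MissesOnly x i → MissesOnly y i →
                            Edge G x y → KColour (col f x y)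
    edge-colour-same-miss {x} {y} {i} 2≤r x-misses@(i∈K , _ , x-nbhd) y-misses@(_ , _ , y-nbhd) xy
      with fresh 2≤r i i
    ... | a , a∈K , a≢i , _ with fresh 2≤r i a
    ... | b , b∈K , b≢i , b≢a
      with square-balanced f r no-template
             (K-minus-three i∈K a∈K b∈K (≢-sym a≢i) (≢-sym b≢i) (≢-sym b≢a))
             (square-isCycle f xy (Edge-sym G (MissesOnly⇒Edge y-misses a∈K a≢i))
                               (K-edge a∈K b∈K (≢-sym b≢a))
                               (MissesOnly⇒Edge x-misses b∈K b≢i)
                               (≢-sym (Edge⇒≢ G (MissesOnly⇒Edge x-misses a∈K a≢i)))
                               (≢-sym (Edge⇒≢ G (MissesOnly⇒Edge y-misses b∈K b≢i))))
             ( InCommonNbhd-anti G p-x-y-z⊆p-x x-nbhd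
             ∷ InCommonNbhd-anti G p-x-y-z⊆p-x y-nbhd
             ∷ InCommonNbhd-anti G p-x-y-z⊆p-y (K-member-nbhd a∈K)
             ∷ InCommonNbhd-anti G p-x-y-z⊆p-z (K-member-nbhd b∈K) ∷ [])
    ... | inj₁ (xy≡ya , _) = i , a , i∈K , a∈K , ≢-sym a≢i , ≡.trans xy≡ya (clone y-misses a∈K a≢i)
    ... | inj₂ (xy≡bx , _) =
      i , b , i∈K , b∈K , ≢-sym b≢i , ≡.trans xy≡bx (≡.trans (colSym f b x) (clone x-misses b∈K b≢i))

    edge-colour-distinct-miss : ∀ {x y i j} → 2 ≤ r → i ≢ j → MissesOnly x i → MissesOnly y j →
                                Edge G x y → KColour (col f x y)
    edge-colour-distinct-miss {x} {y} {i} {j} 2≤r i≢j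
                              x-misses@(i∈K , _ , x-nbhd) y-misses@(j∈K , _ , y-nbhd) xy
      with x ≟ᶠ i | y ≟ᶠ j
    ... | yes refl | _ = j , x , j∈K , i∈K , ≢-sym i≢j , ≡.trans (colSym f x y) (clone y-misses i∈K i≢j)
    ... | no _ | yes refl = i , y , i∈K , j∈K , i≢j , clone x-misses j∈K (≢-sym i≢j)
    ... | no x≢i | no y≢j with fresh 2≤r i j
    ... | t , t∈K , t≢i , t≢j
      with square-balanced f r no-template
             (K-minus-three i∈K j∈K t∈K i≢j (≢-sym t≢i) (≢-sym t≢j))
             (square-isCycle f (Edge-sym G (MissesOnly⇒Edge x-misses j∈K (≢-sym i≢j)))
                               (K-edge j∈K i∈K (≢-sym i≢j))
                               (MissesOnly⇒Edge y-misses i∈K i≢j) (Edge-sym G xy) x≢i (≢-sym y≢j))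
             ( InCommonNbhd-anti G p-x-y-z⊆p-x x-nbhd
             ∷ InCommonNbhd-anti G p-x-y-z⊆p-y (K-member-nbhd j∈K)
             ∷ InCommonNbhd-anti G p-x-y-z⊆p-x (K-member-nbhd i∈K)
             ∷ InCommonNbhd-anti G p-x-y-z⊆p-y y-nbhd ∷ [])
    ... | inj₁ (_ , iy≡yx) = j , i , j∈K , i∈K , ≢-sym i≢j ,
      ≡.trans (colSym f x y) (≡.trans (≡.sym iy≡yx) (≡.trans (colSym f i y) (clone y-misses i∈K i≢j)))
    ... | inj₂ (xj≡yx , _) = i , j , i∈K , j∈K , i≢j ,
      ≡.trans (colSym f x y) (≡.trans (≡.sym xj≡yx) (clone x-misses j∈K (≢-sym i≢j)))

    edge-colour : ∀ {x y i j} → 2 ≤ r → MissesOnly x i → MissesOnly y j → Edge G x y → KColour (col f x y)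
    edge-colour {i = i} {j} 2≤r x-misses y-misses xy with i ≟ᶠ j
    ... | yes refl = edge-colour-same-miss 2≤r x-misses y-misses xy
    ... | no i≢j   = edge-colour-distinct-miss 2≤r i≢j x-misses y-misses xy

  module Maximal (maximal : ∀ K₂ → IsKClique G (r + 2) K₂ → ¬ (K ⊆ K₂)) where

    K-undominated : ∀ v → ¬ InCommonNbhd G K v
    K-undominated v v-nbhd = maximal (K ∪ ⁅ v ⁆) (clique , size) (p⊆p∪q ⁅ v ⁆)
      where
      v∉K : v ∉ K
      v∉K v∈K = Edge⇒≢ G (v-nbhd v v∈K) refl
      clique : IsClique G (K ∪ ⁅ v ⁆)
      clique u w u∈ w∈ u≢w with x∈p∪q⁻ K ⁅ v ⁆ u∈ | x∈p∪q⁻ K ⁅ v ⁆ w∈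
      ... | inj₁ u∈K | inj₁ w∈K = K-edge u∈K w∈K u≢w
      ... | inj₁ u∈K | inj₂ w∈⁅v⁆ rewrite x∈⁅y⁆⇒x≡y v w∈⁅v⁆ = v-nbhd u u∈K
      ... | inj₂ u∈⁅v⁆ | inj₁ w∈K rewrite x∈⁅y⁆⇒x≡y v u∈⁅v⁆ = Edge-sym G (v-nbhd w w∈K)
      ... | inj₂ u∈⁅v⁆ | inj₂ w∈⁅v⁆ =
        contradiction (≡.trans (x∈⁅y⁆⇒x≡y v u∈⁅v⁆) (≡.sym (x∈⁅y⁆⇒x≡y v w∈⁅v⁆))) u≢w
      size : ∣ K ∪ ⁅ v ⁆ ∣ ≡ r + 2
      size = ≡.trans (x∉p⇒∣p∪⁅x⁆∣≡1+∣p∣ v∉K) (≡.trans (cong suc (proj₂ K-clique)) (≡.sym (+-suc r 1)))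

    non-neighbour : ∀ v → ∃ λ i → i ∈ K × ¬ Edge G i v
    non-neighbour v with any? (λ i → i ∈? K ×-dec ¬? (Adj G i v ≟ᵇ true))
    ... | yes found = found
    ... | no none   = ⊥-elim (K-undominated v λ u u∈K →
                        decidable-stable (Adj G u v ≟ᵇ true) λ ¬uv → none (u , u∈K , ¬uv))

    ∣K∩nbrs∣≤r : ∀ v → ∣ K ∩ nbrs G v ∣ ≤ r
    ∣K∩nbrs∣≤r v with non-neighbour v
    ... | i , i∈K , ¬iv = ≤-trans (p⊆q⇒∣p∣≤∣q∣ (∩nbrs⊆- G K ¬iv)) (≤-reflexive (∣K-x∣≡r i∈K))

    misses-only : ∀ {v} → r ≤ ∣ K ∩ nbrs G v ∣ → ∃ (MissesOnly v)
    misses-only {v} r≤∣K∩N∣ with non-neighbour v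
    ... | i , i∈K , ¬iv =
      i , i∈K , ¬iv , λ u u∈K-i → decidable-stable (Adj G u v ≟ᵇ true) (no-second-miss u∈K-i)
      where
      no-second-miss : ∀ {u} → u ∈ K - i → ¬ ¬ Edge G u v
      no-second-miss {u} u∈K-i ¬uv = ≤⇒≯ (≤-trans r≤∣K∩N∣ (p⊆q⇒∣p∣≤∣q∣ K∩N⊆K-i-u))
                                          (≤-reflexive (≡.trans (x∈p⇒1+∣p-x∣≡∣p∣ u∈K-i) (∣K-x∣≡r i∈K)))
        where
        K∩N⊆K-i-u : K ∩ nbrs G v ⊆ K - i - u
        K∩N⊆K-i-u w∈ = x∈p∧x≢y⇒x∈p-y (∩nbrs⊆- G K ¬iv w∈) (proj₂ (x∈p-y⇒x∈p∧x≢y (∩nbrs⊆- G K ¬uv w∈)))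

    U : Subset n
    U = atLeast r (λ v → ∣ K ∩ nbrs G v ∣)

    δ≤∣U∣ : ∀ {δ} → (∀ v → δ ≤ deg G v) → (r ∸ 1) * n ≤ r * δ → δ ≤ ∣ U ∣
    δ≤∣U∣ {δ} δ≤deg rδ≥ = +-cancelʳ-≤ (r * δ) δ ∣ U ∣ (begin
      suc r * δ                       ≡⟨ cong (_* δ) (≡.trans (proj₂ K-clique) (+-comm r 1)) ⟨
      ∣ K ∣ * δ                       ≤⟨ ∣S∣*d≤∑∣S∩nbrs∣ G δ≤deg K ⟩
      ∑[ v < n ] ∣ K ∩ nbrs G v ∣     ≤⟨ ∑≤∣atLeast∣+n*[t∸1] r _ ∣K∩nbrs∣≤r ⟩
      ∣ U ∣ + n * (r ∸ 1)             ≡⟨ cong (∣ U ∣ +_) (*-comm n (r ∸ 1)) ⟩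
      ∣ U ∣ + (r ∸ 1) * n             ≤⟨ +-monoʳ-≤ ∣ U ∣ rδ≥ ⟩
      ∣ U ∣ + r * δ                   ∎)
      where open ≤-Reasoning

lemma4p23 : (r : ℕ) → r ≥ 3 → (n : ℕ) → (G : Graph n) → (f : Coloring G) →
    (δ : ℕ) → IsMinDegree G δ → r * δ ≥ (r ∸ 1) * n →
    ¬ HasTemplate f r →
    (K : Subset n) → IsKClique G (r + 1) K →
    (∀ u → u ∈ K → ¬ Monochromatic f K u) →
    AtMostColors f (r C 2) K →
    (∀ K₂ → IsKClique G (r + 2) K₂ → ¬ (K ⊆ K₂)) →
    Σ (Subset n) λ U → ∣ U ∣ ≥ δ × AtMostColors f (r C 2) U
lemma4p23 r r≥3 n G f δ (δ≤deg , _) rδ≥ no-template K K-clique nonmono (cs , ∣cs∣≤ , K-colours) maximal =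
  U , δ≤∣U∣ δ≤deg rδ≥ , cs , ∣cs∣≤ , U-colours
  where
  open OnClique K-clique
  open Maximal maximal
  open Coloured f no-template nonmono
  U-colours : ∀ x y → x ∈ U → y ∈ U → Edge G x y → col f x y ∈ₗ cs
  U-colours x y x∈U y∈U xy with misses-only (∈atLeast⇒≤ x∈U) | misses-only (∈atLeast⇒≤ y∈U)
  ... | _ , x-misses | _ , y-misses with edge-colour (≤-trans (n≤1+n 2) r≥3) x-misses y-misses xy
  ... | a , b , a∈K , b∈K , a≢b , xy≡ab =
    subst (_∈ₗ cs) (≡.sym xy≡ab) (K-colours a b a∈K b∈K (K-edge a∈K b∈K a≢b))
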